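{- Let $G$ be a directed graph on $n$ vertices, let $k$ be a positive integer, and let $(C,\Lambda)$ be a conflict system on $E(G)$. Suppose that for any two disjoint sets $S,T\subset V(G)$ of size $k$ and any subset $X\subset V(C)$ of size at most $n-1$, there exist an edge $e\in E(G)$ directed from a vertex of $S$ to a vertex of $T$ and an element $y\in\Lambda(e)\setminus X$ which has no conflict with $X$. Then $G$ contains an admissible directed path of length $n-2k+1$.
   Context: Given a set $E$, a conflict system on $E$ is a graph $C$ together with a map $\Lambda\colon E\to 2^{V(C)}$. A subset $E'\subset E$ is admissible (with respect to $C,\Lambda$) if one can choose for every $e\in E'$ a representative in $\Lambda(e)$ such that the chosen representatives are pairwise distinct and form an independent set in $C$. A directed path in $G$ is admissible if its edge set is admissible. An element $y\in V(C)$ has no conflict with $X\subset V(C)$ if there is no edge of $C$ between $y$ and $X$. -}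

module Defs where

open import Data.Nat using (ℕ; suc; _≤_; _∸_)
open import Data.Bool using (Bool; true)
open import Data.Fin using (Fin; inject₁) renaming (suc to fsuc)
open import Data.Fin.Subset using (Subset; _∈_; _∉_; ∣_∣)
open import Data.List using (List; length)
import Data.List.Membership.Propositional as LM
open import Data.Product using (Σ; ∃; _×_; _,_)
open import Relation.Binary.PropositionalEquality using (_≡_)
open import Relation.Nullary using (¬_)
open import Function.Definitions using (Injective)

record DiGraph (n : ℕ) : Set where
  field
    adj : Fin n → Fin n → Bool

record Graph : Set₁ where
  field
    V      : Set
    _~_    : V → V → Set
    ~-sym  : ∀ {x y} → x ~ y → y ~ x
    ~-irr  : ∀ {x} → ¬ (x ~ x)

module _ {n : ℕ} (G : DiGraph n) where
  open DiGraph G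

  Edge : Set
  Edge = Σ (Fin n) λ u → Σ (Fin n) λ v → adj u v ≡ true

  record ConflictSystem : Set₁ where
    field
      C : Graph
      Λ : Edge → Graph.V C → Set

  module _ (CS : ConflictSystem) where
    open ConflictSystem CS
    open Graph C

    NoConflict : V → List V → Set
    NoConflict y X = ∀ {x} → x LM.∈ X → ¬ (x ~ y)

    record DirPath (L : ℕ) : Set where
      field
        vert     : Fin (suc L) → Fin n
        distinct : Injective _≡_ _≡_ vert
        step     : (i : Fin L) → adj (vert (inject₁ i)) (vert (fsuc i)) ≡ true

      edge : Fin L → Edge
      edge i = vert (inject₁ i) , vert (fsuc i) , step i

    -- A path is admissible if its edge set is admissible: representatives
    -- r i ∈ Λ(e_i), pairwise distinct, forming an independent set of C.
    Admissible : ∀ {L} → DirPath L → Set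
    Admissible {L} P =
      Σ (Fin L → V) λ r →
        ((i : Fin L) → Λ (DirPath.edge P i) (r i)) ×
        Injective _≡_ _≡_ r ×
        (∀ i j → ¬ (r i ~ r j))

    Hyp : ℕ → Set
    Hyp k =
      ∀ (S T : Subset n) → ∣ S ∣ ≡ k → ∣ T ∣ ≡ k → (∀ x → x ∈ S → x ∉ T) →
      ∀ (X : List V) → length X ≤ n ∸ 1 →
      Σ (Fin n) λ u → Σ (Fin n) λ v → Σ (adj u v ≡ true) λ e →
        u ∈ S × v ∈ T × Σ V λ y →
          Λ (u , v , e) y × ¬ (y LM.∈ X) × NoConflict y X

-- Depth-first search, growing the path backwards. The search keeps a set T of unvisited
-- vertices, a set S of retired vertices and an admissible path, and repeatedly retires the
-- first vertex u of the path. When retiring u makes |S| = k, either |T| < k, and then the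
-- path (still containing u) has n - (k - 1) - |T| ≥ n - 2k + 2 vertices, or the hypothesis,
-- applied to a k-subset of T and to S with X the list of all representatives chosen so far,
-- yields an edge from T into S with a fresh, conflict-free representative. Such an edge stays
-- fresh as X grows and T shrinks, so it is handed back to the moment its endpoint v was
-- retired, where its tail is prepended to the path instead of retiring v. Returning the edge
-- as evidence replaces the classical case distinction "does v have a fresh in-edge from T?",
-- which is undecidable here; at the start S is empty, so no edge can be returned.
module Submission where

open import Defs
open import Data.Bool using (true)
open import Data.Nat using (ℕ; zero; suc; _+_; _*_; _∸_; _≤_; _<_; _≤′_; ≤′-reflexive; ≤′-step; z≤n; s≤s)
open import Data.Nat.Properties
open import Data.Nat.Tactic.RingSolver using (solve-∀)
open import Data.Fin using (Fin; zero; suc; inject₁)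
import Data.Fin.Properties as Fin
open import Data.Fin.Subset using (Subset; _∈_; _∉_; _⊆_; ∣_∣; ⊥; ⊤; ⁅_⁆; _∪_; _-_; Nonempty; inside; outside)
open import Data.Fin.Subset.Properties
  using (∪-identityˡ; x∈p∪q⁻; x∈⁅y⁆⇒x≡y; p─q⊆p; p─⊥≡p; ∣⊥∣≡0; ∣⊤∣≡n; ∉⊥; nonempty?; Empty-unique; in⊆in; out⊆; ⊥⊆)
open import Data.Vec using (_∷_; here; there)
open import Data.Vec.Functional as Vector using (Vector)
open import Data.List using (List; []; _∷_; length)
import Data.List.Membership.Propositional as List
open import Data.List.Relation.Unary.Any using () renaming (here to here′; there to there′)
open import Data.Product using (Σ; ∃; _×_; _,_; proj₁; proj₂)
open import Data.Sum using (_⊎_; inj₁; inj₂; [_,_]′; map₂)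
open import Function using (_∘_; id)
open import Function.Definitions using (Injective)
open import Relation.Binary.PropositionalEquality using (_≡_; _≢_; refl; sym; trans; cong; subst)
open import Relation.Nullary using (¬_; yes; no; contradiction)

∣⁅x⁆∪p∣≡1+∣p∣ : ∀ {n} {x : Fin n} {p : Subset n} → x ∉ p → ∣ ⁅ x ⁆ ∪ p ∣ ≡ suc ∣ p ∣
∣⁅x⁆∪p∣≡1+∣p∣ {x = zero}  {inside  ∷ p} x∉p = contradiction here x∉p
∣⁅x⁆∪p∣≡1+∣p∣ {x = zero}  {outside ∷ p} _   = cong (suc ∘ ∣_∣) (∪-identityˡ p)
∣⁅x⁆∪p∣≡1+∣p∣ {x = suc x} {inside  ∷ p} x∉p = cong suc (∣⁅x⁆∪p∣≡1+∣p∣ (x∉p ∘ there))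
∣⁅x⁆∪p∣≡1+∣p∣ {x = suc x} {outside ∷ p} x∉p = ∣⁅x⁆∪p∣≡1+∣p∣ (x∉p ∘ there)

1+∣p-x∣≡∣p∣ : ∀ {n} {x : Fin n} {p : Subset n} → x ∈ p → suc ∣ p - x ∣ ≡ ∣ p ∣
1+∣p-x∣≡∣p∣ {x = zero}  {inside  ∷ p} here      = cong (suc ∘ ∣_∣) (p─⊥≡p p)
1+∣p-x∣≡∣p∣ {x = suc x} {inside  ∷ p} (there h) = cong suc (1+∣p-x∣≡∣p∣ h)
1+∣p-x∣≡∣p∣ {x = suc x} {outside ∷ p} (there h) = 1+∣p-x∣≡∣p∣ h

x∉p-x : ∀ {n} (x : Fin n) (p : Subset n) → x ∉ p - x
x∉p-x zero    (_ ∷ p) ()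
x∉p-x (suc x) (_ ∷ p) (there h) = x∉p-x x p h

∣p∣>0⇒nonempty : ∀ {n} (p : Subset n) → 0 < ∣ p ∣ → Nonempty p
∣p∣>0⇒nonempty {n} p ∣p∣>0 with nonempty? p
... | yes ne = ne
... | no  ¬ne = contradiction (subst (λ q → 0 < ∣ q ∣) (Empty-unique ¬ne) ∣p∣>0) (<-irrefl (sym (∣⊥∣≡0 n)))

⊆-withSize : ∀ {n} (p : Subset n) k → k ≤ ∣ p ∣ → ∃ λ q → q ⊆ p × ∣ q ∣ ≡ k
⊆-withSize {n} p zero _ = ⊥ , ⊥⊆ , ∣⊥∣≡0 n
⊆-withSize (inside ∷ p) (suc k) (s≤s k≤∣p∣) with ⊆-withSize p k k≤∣p∣
... | q , q⊆p , ∣q∣≡k = inside ∷ q , in⊆in q⊆p , cong suc ∣q∣≡k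
⊆-withSize (outside ∷ p) (suc k) k<∣p∣ with ⊆-withSize p (suc k) k<∣p∣
... | q , q⊆p , ∣q∣≡k = outside ∷ q , out⊆ q⊆p , ∣q∣≡k

∷-injective : ∀ {A : Set} {m} {x : A} {f : Vector A m} →
  Injective _≡_ _≡_ f → (∀ i → f i ≢ x) → Injective _≡_ _≡_ (x Vector.∷ f)
∷-injective f-inj x∉f {zero}  {zero}  _  = refl
∷-injective f-inj x∉f {zero}  {suc j} eq = contradiction (sym eq) (x∉f j)
∷-injective f-inj x∉f {suc i} {zero}  eq = contradiction eq (x∉f i)
∷-injective f-inj x∉f {suc i} {suc j} eq = cong suc (f-inj eq)

module AdmissiblePaths {n : ℕ} (G : DiGraph n) (CS : ConflictSystem G) where
  open DiGraph G
  open ConflictSystem CS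
  open Graph C

  AdmissiblePath : ℕ → Set
  AdmissiblePath m = Σ (DirPath G CS m) (Admissible G CS)

  vertex : ∀ {m} → AdmissiblePath m → Fin (suc m) → Fin n
  vertex = DirPath.vert ∘ proj₁

  rep : ∀ {m} → AdmissiblePath m → Fin m → V
  rep = proj₁ ∘ proj₂

  trivialPath : Fin n → AdmissiblePath 0
  trivialPath v = record { vert = λ _ → v ; distinct = λ { {zero} {zero} _ → refl } ; step = λ () }
                , (λ ()) , (λ ()) , (λ { {()} }) , λ ()

  tail : ∀ {m} → AdmissiblePath (suc m) → AdmissiblePath m
  tail (record { vert = vert ; distinct = distinct ; step = step } , r , r∈Λ , r-inj , r-indep) =
    record { vert = Vector.tail vert ; distinct = Fin.suc-injective ∘ distinct ; step = step ∘ suc }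
    , Vector.tail r , r∈Λ ∘ suc , Fin.suc-injective ∘ r-inj , λ i j → r-indep (suc i) (suc j)

  shorten : ∀ {L m} → L ≤′ m → AdmissiblePath m → AdmissiblePath L
  shorten (≤′-reflexive refl) P = P
  shorten (≤′-step L≤′m)      P = shorten L≤′m (tail P)

  prepend : ∀ {m} (P : AdmissiblePath m) a (e : adj a (vertex P zero) ≡ true) y →
    Λ (a , vertex P zero , e) y → (∀ i → vertex P i ≢ a) →
    (∀ i → rep P i ≢ y) → (∀ i → ¬ (rep P i ~ y)) → AdmissiblePath (suc m)
  prepend {m} (record { vert = vert ; distinct = distinct ; step = step } , r , r∈Λ , r-inj , r-indep)
          a e y y∈Λ a∉P y∉r y≁r =
    P′ , y Vector.∷ r , r∈Λ′ , ∷-injective r-inj y∉r , indep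
    where
    step′ : ∀ i → adj ((a Vector.∷ vert) (inject₁ i)) ((a Vector.∷ vert) (suc i)) ≡ true
    step′ zero    = e
    step′ (suc i) = step i
    P′ : DirPath G CS (suc m)
    P′ = record { vert = a Vector.∷ vert ; distinct = ∷-injective distinct a∉P ; step = step′ }
    r∈Λ′ : ∀ i → Λ (DirPath.edge P′ i) ((y Vector.∷ r) i)
    r∈Λ′ zero    = y∈Λ
    r∈Λ′ (suc i) = r∈Λ i
    indep : ∀ i j → ¬ ((y Vector.∷ r) i ~ (y Vector.∷ r) j)
    indep zero    zero    = ~-irr
    indep zero    (suc j) = y≁r j ∘ ~-sym
    indep (suc i) zero    = y≁r i
    indep (suc i) (suc j) = r-indep i j

module FreshEdges {n : ℕ} (G : DiGraph n) (CS : ConflictSystem G) where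
  open DiGraph G
  open ConflictSystem CS
  open Graph C

  FreshEdge : Subset n → Subset n → List V → Set
  FreshEdge A B X =
    Σ (Fin n) λ u → Σ (Fin n) λ v → Σ (adj u v ≡ true) λ e →
      u ∈ A × v ∈ B × Σ V λ y → Λ (u , v , e) y × ¬ (y List.∈ X) × NoConflict G CS y X

  FreshEdge-mono : ∀ {A A′ B B′ X X′} → A ⊆ A′ → B ⊆ B′ → (∀ {x} → x List.∈ X′ → x List.∈ X) →
    FreshEdge A B X → FreshEdge A′ B′ X′
  FreshEdge-mono A⊆A′ B⊆B′ X′⊆X (u , v , e , u∈A , v∈B , y , y∈Λ , y∉X , y≁X) =
    u , v , e , A⊆A′ u∈A , B⊆B′ v∈B , y , y∈Λ , y∉X ∘ X′⊆X , y≁X ∘ X′⊆X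

k≤n : ∀ {k n} → 1 ≤ k → 2 * k ≤ suc n → k ≤ n
k≤n {k} {n} 1≤k 2k≤1+n = ≤-pred (begin
  suc k      ≡⟨ +-comm 1 k ⟩
  k + 1      ≤⟨ +-monoʳ-≤ k 1≤k ⟩
  k + k      ≡⟨ cong (k +_) (sym (+-identityʳ k)) ⟩
  2 * k      ≤⟨ 2k≤1+n ⟩
  suc n      ∎)
  where open ≤-Reasoning

long-enough : ∀ {s t m k n} → s + t + suc m ≡ n → suc s ≤ k → suc t ≤ k → suc n ∸ 2 * k ≤ m
long-enough {s} {t} {m} {k} refl 1+s≤k 1+t≤k = m≤n+o⇒m∸n≤o (suc (s + t + suc m)) (2 * k) (begin
  suc (s + t + suc m)  ≡⟨ rearrange s t m ⟩
  suc s + suc t + m    ≤⟨ +-monoˡ-≤ m (+-mono-≤ 1+s≤k 1+t≤k) ⟩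
  k + k + m            ≡⟨ cong (λ j → k + j + m) (sym (+-identityʳ k)) ⟩
  2 * k + m            ∎)
  where
  open ≤-Reasoning
  rearrange : ∀ s t m → suc (s + t + suc m) ≡ suc s + suc t + m
  rearrange = solve-∀

module DepthFirstSearch {n : ℕ} (G : DiGraph n) (CS : ConflictSystem G) {k : ℕ}
  (1≤k : 1 ≤ k) (2k≤1+n : 2 * k ≤ suc n) (hyp : Hyp G CS k) where
  open DiGraph G
  open ConflictSystem CS
  open Graph C
  open AdmissiblePaths G CS
  open FreshEdges G CS

  -- R holds every representative chosen so far, not only those on the current path; every
  -- push adds one to R and removes one vertex from T, whence the budget.
  record Frontier (s t : ℕ) : Set where
    field
      S T    : Subset n
      R      : List V
      ∣S∣≡s  : ∣ S ∣ ≡ s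
      ∣T∣≡t  : ∣ T ∣ ≡ t
      S∩T≡∅  : ∀ {x} → x ∈ S → x ∉ T
      budget : length R + t ≤ n

  open Frontier

  Outcome : ∀ {s t} → Frontier s t → Set
  Outcome F = AdmissiblePath (suc n ∸ 2 * k) ⊎ FreshEdge (T F) (S F) (R F)

  record Stack {s t} (F : Frontier s t) (m : ℕ) : Set where
    field
      path   : AdmissiblePath m
      avoids : ∀ i → vertex path i ∉ S F × vertex path i ∉ T F
      reps∈R : ∀ i → rep path i List.∈ R F

  open Stack

  top : ∀ {s t m} {F : Frontier s t} → Stack F m → Fin n
  top σ = vertex (path σ) zero

  retireTop : ∀ {s t m} (F : Frontier s t) → Stack F m → Frontier (suc s) t
  retireTop F σ = record
    { S      = ⁅ top σ ⁆ ∪ S F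
    ; T      = T F
    ; R      = R F
    ; ∣S∣≡s  = trans (∣⁅x⁆∪p∣≡1+∣p∣ (proj₁ (avoids σ zero))) (cong suc (∣S∣≡s F))
    ; ∣T∣≡t  = ∣T∣≡t F
    ; S∩T≡∅  = λ x∈S′ → [ (λ x∈top → subst (_∉ T F) (sym (x∈⁅y⁆⇒x≡y _ x∈top)) (proj₂ (avoids σ zero)))
                        , S∩T≡∅ F ]′ (x∈p∪q⁻ ⁅ top σ ⁆ (S F) x∈S′)
    ; budget = budget F
    }

  popTop : ∀ {s t m} (F : Frontier s t) (σ : Stack F (suc m)) → Stack (retireTop F σ) m
  popTop F σ = record
    { path   = tail (path σ)
    ; avoids = λ i → avoidsS′ i , proj₂ (avoids σ (suc i))
    ; reps∈R = reps∈R σ ∘ suc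
    }
    where
    avoidsS′ : ∀ i → vertex (path σ) (suc i) ∉ ⁅ top σ ⁆ ∪ S F
    avoidsS′ i x∈S′ = [ (λ x∈top → Fin.0≢1+n (sym (DirPath.distinct (proj₁ (path σ)) (x∈⁅y⁆⇒x≡y _ x∈top))))
                      , proj₁ (avoids σ (suc i)) ]′ (x∈p∪q⁻ ⁅ top σ ⁆ (S F) x∈S′)

  visit : ∀ {s t a} (F : Frontier s (suc t)) → a ∈ T F → (R′ : List V) → length R′ + t ≤ n → Frontier s t
  visit {a = a} F a∈T R′ budget′ = record
    { S      = S F
    ; T      = T F - a
    ; R      = R′
    ; ∣S∣≡s  = ∣S∣≡s F
    ; ∣T∣≡t  = suc-injective (trans (1+∣p-x∣≡∣p∣ a∈T) (∣T∣≡t F))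
    ; S∩T≡∅  = λ x∈S x∈T′ → S∩T≡∅ F x∈S (p─q⊆p (T F) ⁅ a ⁆ x∈T′)
    ; budget = budget′
    }

  start : ∀ {s t a} (F : Frontier s (suc t)) → a ∈ T F → Frontier s t
  start {t = t} F a∈T = visit F a∈T (R F) (≤-trans (+-monoʳ-≤ (length (R F)) (n≤1+n t)) (budget F))

  startStack : ∀ {s t a} (F : Frontier s (suc t)) (a∈T : a ∈ T F) → Stack (start F a∈T) 0
  startStack {a = a} F a∈T = record
    { path   = trivialPath a
    ; avoids = λ _ → (λ a∈S → S∩T≡∅ F a∈S a∈T) , x∉p-x a (T F)
    ; reps∈R = λ ()
    }

  push : ∀ {s t a} (F : Frontier s (suc t)) → a ∈ T F → V → Frontier s t
  push {t = t} F a∈T y = visit F a∈T (y ∷ R F) (≤-trans (≤-reflexive (sym (+-suc (length (R F)) t))) (budget F))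

  pushStack : ∀ {s t m a} (F : Frontier s (suc t)) (σ : Stack F m) (e : adj a (top σ) ≡ true)
    (a∈T : a ∈ T F) y → Λ (a , top σ , e) y → ¬ (y List.∈ R F) → NoConflict G CS y (R F) →
    Stack (push F a∈T y) (suc m)
  pushStack {m = m} {a = a} F σ e a∈T y y∈Λ y∉R y≁R = record
    { path   = P
    ; avoids = avoids′
    ; reps∈R = reps∈R′
    }
    where
    P : AdmissiblePath (suc m)
    P = prepend (path σ) a e y y∈Λ
          (λ i eq → proj₂ (avoids σ i) (subst (_∈ T F) (sym eq) a∈T))
          (λ i eq → y∉R (subst (List._∈ R F) eq (reps∈R σ i)))
          (λ i → y≁R (reps∈R σ i))
    avoids′ : ∀ i → vertex P i ∉ S F × vertex P i ∉ T F - a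
    avoids′ zero    = (λ a∈S → S∩T≡∅ F a∈S a∈T) , x∉p-x a (T F)
    avoids′ (suc i) = proj₁ (avoids σ i) , proj₂ (avoids σ i) ∘ p─q⊆p (T F) ⁅ a ⁆
    reps∈R′ : ∀ i → rep P i List.∈ y ∷ R F
    reps∈R′ zero    = here′ refl
    reps∈R′ (suc i) = there′ (reps∈R σ i)

  fresh-entry : ∀ {s t} → k ≤ t → s ≡ k → (F : Frontier s t) → FreshEdge (T F) (S F) (R F)
  fresh-entry k≤t s≡k F with ⊆-withSize (T F) k (subst (k ≤_) (sym (∣T∣≡t F)) k≤t)
  ... | T₀ , T₀⊆T , ∣T₀∣≡k =
    FreshEdge-mono T₀⊆T id id
      (hyp T₀ (S F) ∣T₀∣≡k (trans (∣S∣≡s F) s≡k) (λ _ x∈T₀ x∈S → S∩T≡∅ F x∈S (T₀⊆T x∈T₀)) (R F) R-short)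
    where
    R-short : length (R F) ≤ n ∸ 1
    R-short = m+n≤o⇒m≤o∸n (length (R F)) (≤-trans (+-monoʳ-≤ (length (R F)) (≤-trans 1≤k k≤t)) (budget F))

  -- Every cycle of calls either removes a vertex from T or, leaving T unchanged, shortens the path.
  explore : ∀ {s} t → s < k → s + t ≡ n → (F : Frontier s t) → Outcome F
  search  : ∀ {s} t m → s < k → s + t + suc m ≡ n → (F : Frontier s t) → Stack F m → Outcome F
  retreat : ∀ {s} t m → s < k → s + t + suc m ≡ n → (F : Frontier s t) (σ : Stack F m) →
            Outcome (retireTop F σ)
  reenter : ∀ {s} t m → s < k → s + t + suc m ≡ n → (F : Frontier s t) (σ : Stack F m) →
            Outcome (retireTop F σ) → Outcome F
  extend  : ∀ {s} t m → s < k → s + t + suc m ≡ n → (F : Frontier s t) (σ : Stack F m) →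
            ∀ a (e : adj a (top σ) ≡ true) → a ∈ T F → ∀ y → Λ (a , top σ , e) y →
            ¬ (y List.∈ R F) → NoConflict G CS y (R F) → Outcome F

  explore {s} zero s<k s+0≡n _ = contradiction (subst (_< k) (trans (sym (+-identityʳ s)) s+0≡n) s<k)
                                               (≤⇒≯ (k≤n 1≤k 2k≤1+n))
  explore {s} (suc t) s<k count F with ∣p∣>0⇒nonempty (T F) (subst (0 <_) (sym (∣T∣≡t F)) (s≤s z≤n))
  ... | a , a∈T = map₂ (FreshEdge-mono (p─q⊆p (T F) ⁅ a ⁆) id id)
                       (search t 0 s<k (trans (rearrange s t) count) (start F a∈T) (startStack F a∈T))
    where
    rearrange : ∀ s t → s + t + 1 ≡ s + suc t
    rearrange = solve-∀

  search t m s<k count F σ = reenter t m s<k count F σ (retreat t m s<k count F σ)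

  retreat t m s<k count F σ with m≤n⇒m<n∨m≡n s<k
  retreat {s} t zero s<k count F σ | inj₁ 1+s<k =
    explore t 1+s<k (trans (rearrange s t) count) (retireTop F σ)
    where
    rearrange : ∀ s t → suc s + t ≡ s + t + 1
    rearrange = solve-∀
  retreat {s} t (suc m) s<k count F σ | inj₁ 1+s<k =
    search t m 1+s<k (trans (rearrange s t m) count) (retireTop F σ) (popTop F σ)
    where
    rearrange : ∀ s t m → suc s + t + suc m ≡ s + t + suc (suc m)
    rearrange = solve-∀
  retreat t m s<k count F σ | inj₂ 1+s≡k with t <? k
  ... | yes t<k = inj₁ (shorten (≤⇒≤′ (long-enough count s<k t<k)) (path σ))
  ... | no  t≮k = inj₂ (fresh-entry (≮⇒≥ t≮k) 1+s≡k (retireTop F σ))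

  reenter _ _ _ _ _ _ (inj₁ long) = inj₁ long
  reenter t m s<k count F σ (inj₂ (a , v , e , a∈T , v∈S′ , y , y∈Λ , y∉R , y≁R))
    with x∈p∪q⁻ ⁅ top σ ⁆ (S F) v∈S′
  ... | inj₂ v∈S = inj₂ (a , v , e , a∈T , v∈S , y , y∈Λ , y∉R , y≁R)
  ... | inj₁ v∈top with x∈⁅y⁆⇒x≡y (top σ) v∈top
  ...   | refl = extend t m s<k count F σ a e a∈T y y∈Λ y∉R y≁R

  extend zero _ _ _ F _ _ _ a∈T _ _ _ _ =
    contradiction (trans (1+∣p-x∣≡∣p∣ a∈T) (∣T∣≡t F)) λ ()
  extend {s} (suc t) m s<k count F σ a e a∈T y y∈Λ y∉R y≁R =
    map₂ (FreshEdge-mono (p─q⊆p (T F) ⁅ a ⁆) id there′)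
         (search t (suc m) s<k (trans (rearrange s t m) count)
                 (push F a∈T y) (pushStack F σ e a∈T y y∈Λ y∉R y≁R))
    where
    rearrange : ∀ s t m → s + t + suc (suc m) ≡ s + suc t + suc m
    rearrange = solve-∀

lemma4p1 : ∀ (n : ℕ) (G : DiGraph n) (k : ℕ) → 1 ≤ k → 2 * k ≤ suc n →
    (CS : ConflictSystem G) → Hyp G CS k →
    Σ (DirPath G CS (suc n ∸ 2 * k)) λ P → Admissible G CS P
lemma4p1 n G k 1≤k 2k≤1+n CS hyp =
  [ id , (λ (_ , _ , _ , _ , v∈⊥ , _) → contradiction v∈⊥ ∉⊥) ]′ (explore n 1≤k refl F₀)
  where
  open DepthFirstSearch G CS 1≤k 2k≤1+n hyp
  F₀ : Frontier 0 n
  F₀ = record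
    { S = ⊥ ; T = ⊤ ; R = [] ; ∣S∣≡s = ∣⊥∣≡0 n ; ∣T∣≡t = ∣⊤∣≡n n
    ; S∩T≡∅ = λ x∈⊥ _ → ∉⊥ x∈⊥ ; budget = ≤-refl }
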